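{- For every odd integer $n\ge 3$, $$\sum_{\substack{0\le k\le n\\ 6\mid k-3}}\binom nk3^kB_{n-k}=\begin{cases}\frac n3\big(1+2^{n-1}-\frac{3^{n-1}}2-V_{n-1}(1,7)\big)&\text{if } 6\mid n-1,\\ \frac n3\big(1+2^{n-1}+3^{n-1}-V_{n-1}(1,7)\big)&\text{if } 6\nmid n-1.\end{cases}$$
   Context: The Bernoulli numbers $B_n$ are defined by $B_0=1$ and $\sum_{k=0}^{n-1}\binom nkB_k=0$ for $n\ge 2$. For numbers $b,c$, the Lucas sequence $V_n(b,c)$ is defined by $V_0(b,c)=2$, $V_1(b,c)=b$, $V_{n+1}(b,c)=bV_n(b,c)-cV_{n-1}(b,c)$ for $n\ge1$. -}

module Defs where

open import Data.Nat as ℕ using (ℕ; zero; suc; _∸_)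
open import Data.Nat.Combinatorics using (_C_)
open import Data.Integer as ℤ using (ℤ; +_)
open import Data.Integer.Divisibility.Signed using (_∣?_)
open import Data.Rational using (ℚ; 0ℚ; 1ℚ; _+_; _*_; -_; _/_)
open import Data.Vec using (Vec; []; _∷_; lookup; _∷ʳ_)
open import Data.Fin using (Fin; fromℕ<)
open import Data.Fin.Properties using ()
open import Data.Nat.Properties using (n<1+n; ≤-refl)
open import Relation.Nullary.Decidable using (does)
open import Data.Bool using (if_then_else_)
open import Relation.Nullary using (yes; no)

ℕ→ℚ : ℕ → ℚ
ℕ→ℚ n = (+ n) / 1

sumTo : ℕ → (ℕ → ℚ) → ℚ
sumTo zero    f = f 0
sumTo (suc n) f = sumTo n f + f (suc n)

sumBelow : ℕ → (ℕ → ℚ) → ℚ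
sumBelow zero    f = 0ℚ
sumBelow (suc m) f = sumBelow m f + f m

-- B_0 = 1, and for m ≥ 1 the defining relation
-- Σ_{k=0}^{m} C(m+1,k) B_k = 0 (i.e. the paper's relation with n = m+1 ≥ 2)
-- is solved for B_m:  B_m = -(1/(m+1)) Σ_{k=0}^{m-1} C(m+1,k) B_k.
bernoulliTable : (n : ℕ) → Vec ℚ (suc n)
bernoulliTable zero    = 1ℚ ∷ []
bernoulliTable (suc n) = prev ∷ʳ next
  where
  prev : Vec ℚ (suc n)
  prev = bernoulliTable n
  entry : ℕ → ℚ
  entry k with k ℕ.<? suc n
  ... | yes k<  = lookup prev (fromℕ< k<)
  ... | no _    = 0ℚ
  next : ℚ
  next = - ((+ 1 / suc (suc n)) * sumBelow (suc n) (λ k → ℕ→ℚ ((suc (suc n)) C k) * entry k))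

-- Bernoulli number B_n (convention B_1 = -1/2, forced by the recurrence)
B : ℕ → ℚ
B n = lookup (bernoulliTable n) (fromℕ< (n<1+n n))

V : ℕ → ℤ → ℤ → ℤ
V zero          b c = + 2
V (suc zero)    b c = b
V (suc (suc n)) b c = b ℤ.* V (suc n) b c ℤ.- c ℤ.* V n b c

lhs : ℕ → ℚ
lhs n = sumTo n (λ k →
  if does (+ 6 ∣? (+ k ℤ.- + 3))
  then ℕ→ℚ ((n C k) ℕ.* (3 ℕ.^ k)) * B (n ∸ k)
  else 0ℚ)

{-# OPTIONS --safe #-}
-- In exponential generating functions the sum is the coefficient of xⁿ/n! in
-- F(x) · x/(eˣ - 1), where F(x) = Σ_{k ≡ 3 mod 6} (3x)ᵏ/k!. Filtering over the sixth roots of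
-- unity gives 6F = e^{3x} - e^{-3x} - W₊ + W₋, where W± generate the Lucas sequences
-- V(±3,9). Multiplication by eˣ shifts the roots of a Lucas sequence by 1, so 6F = (eˣ - 1) H
-- for an explicit combination H of six exponentials and three Lucas generating functions.
-- Hence the sum is n H(n-1)/6. At the even index m = n-1 the terms of H pair up, since
-- a^m = (-a)^m and V(-p,q) and V(p,q) agree there; what remains involves
-- V_m(3,9) = 3^m V_m(1,1), and V(1,1) has period 6.
module Submission where

open import Level using (0ℓ)
open import Agda.Builtin.FromNat using (Number; fromNat)
open import Agda.Builtin.FromNeg using (Negative)
open import Data.Unit.Base using (tt)
open import Data.Maybe.Base using (Maybe; just; nothing)
open import Data.Bool using (true; false; if_then_else_)
open import Data.Empty using (⊥-elim)
open import Data.Product using (Σ; _,_; proj₁; proj₂; uncurry)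
open import Data.List as List using (List; []; _∷_)
open import Data.Sum using (inj₁; inj₂)
open import Function.Base using (_∘_)
open import Relation.Nullary using (yes; no)
open import Relation.Nullary.Decidable using (does; does-⇔)
open import Function.Bundles using (mk⇔)
open import Relation.Binary.PropositionalEquality
  using (_≗_; refl; sym; trans; cong; cong₂; module ≡-Reasoning)

open import Data.Nat as ℕ using (zero; suc; s≤s)
import Data.Nat.Properties as ℕ
import Data.Nat.Literals as ℕ
open import Data.Nat.Combinatorics
  using (_C_; nCk+nC[k+1]≡[n+1]C[k+1]; k>n⇒nCk≡0; nCn≡1; nCk≡nC[n∸k]; nC1≡n)
open import Data.Nat.DivMod using (m≡m%n+[m/n]*n)
open import Data.Nat.Divisibility using (divides; ∣m+n∣m⇒∣n; ∣m∣n⇒∣m+n; ∣-refl; ∣⇒≤)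
open import Data.Integer as ℤ using (ℤ)
import Data.Integer.Properties as ℤ
import Data.Integer.Divisibility.Signed as ℤ
open import Data.Integer.Tactic.RingSolver as ℤ-Solver using ()
open import Data.Rational using (0ℚ; 1ℚ; -_; toℚᵘ; fromℚᵘ)
open import Data.Rational.Properties
  using (+-*-commutativeRing; _≟_;
         toℚᵘ-injective; toℚᵘ-fromℚᵘ; fromℚᵘ-cong;
         toℚᵘ-homo-+; toℚᵘ-homo-*; toℚᵘ-homo‿-;
         *-zeroˡ; *-assoc; *-identityˡ; *-identityʳ; +-identityˡ; +-identityʳ; +-assoc; +-comm)
open import Data.Rational.Base using (+-*-rawSemiring)
import Data.Rational.Literals as ℚ
open import Data.Rational.Unnormalised as ℚᵘ using (mkℚᵘ; *≡*)
import Data.Rational.Unnormalised.Properties as ℚᵘ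
open import Algebra.Definitions.RawSemiring +-*-rawSemiring using () renaming (_^_ to _^ℚ_)
open import Algebra.Bundles using (CommutativeRing)
open import Algebra.Properties.CommutativeSemiring.Exp (CommutativeRing.commutativeSemiring +-*-commutativeRing)
  using () renaming (^-distrib-* to ^ℚ-distrib-*)
open import Tactic.RingSolver using (solve-∀)
import Tactic.RingSolver.Core.AlmostCommutativeRing as ACR
open import Data.Vec using (Vec; []; _∷_; lookup; _∷ʳ_)
open import Data.Fin using (fromℕ<)

open import Defs
open import Data.Nat using (ℕ; _≥_; _%_; _∸_; _^_)
open import Data.Nat.Divisibility using (_∣_)
open import Data.Integer using (+_)
open import Data.Rational using (ℚ; _+_; _-_; _*_; _/_)
open import Data.Product using (_×_)
open import Relation.Nullary using (¬_)
open import Relation.Binary.PropositionalEquality using (_≡_)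

instance
  ℕ-number : Number ℕ
  ℕ-number = ℕ.number
  ℚ-number : Number ℚ
  ℚ-number = ℚ.number
  ℚ-negative : Negative ℚ
  ℚ-negative = ℚ.negative

ℚ-ring : ACR.AlmostCommutativeRing 0ℓ 0ℓ
ℚ-ring = ACR.fromCommutativeRing +-*-commutativeRing isZero
  where
  isZero : (x : ℚ) → Maybe (0ℚ ≡ x)
  isZero x with 0ℚ ≟ x
  ... | yes p = just p
  ... | no _  = nothing

-- Embedding ℤ and ℕ into ℚ

ℤ→ℚ : ℤ → ℚ
ℤ→ℚ i = i / 1

fromℚᵘ-homo-+ : ∀ p q → fromℚᵘ (p ℚᵘ.+ q) ≡ fromℚᵘ p + fromℚᵘ q
fromℚᵘ-homo-+ p q = toℚᵘ-injective (begin
  toℚᵘ (fromℚᵘ (p ℚᵘ.+ q))             ≈⟨ toℚᵘ-fromℚᵘ (p ℚᵘ.+ q) ⟩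
  p ℚᵘ.+ q                             ≈⟨ ℚᵘ.+-cong (ℚᵘ.≃-sym (toℚᵘ-fromℚᵘ p)) (ℚᵘ.≃-sym (toℚᵘ-fromℚᵘ q)) ⟩
  toℚᵘ (fromℚᵘ p) ℚᵘ.+ toℚᵘ (fromℚᵘ q) ≈⟨ ℚᵘ.≃-sym (toℚᵘ-homo-+ (fromℚᵘ p) (fromℚᵘ q)) ⟩
  toℚᵘ (fromℚᵘ p + fromℚᵘ q)           ∎)
  where open ℚᵘ.≃-Reasoning

fromℚᵘ-homo-* : ∀ p q → fromℚᵘ (p ℚᵘ.* q) ≡ fromℚᵘ p * fromℚᵘ q
fromℚᵘ-homo-* p q = toℚᵘ-injective (begin
  toℚᵘ (fromℚᵘ (p ℚᵘ.* q))             ≈⟨ toℚᵘ-fromℚᵘ (p ℚᵘ.* q) ⟩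
  p ℚᵘ.* q                             ≈⟨ ℚᵘ.*-cong (ℚᵘ.≃-sym (toℚᵘ-fromℚᵘ p)) (ℚᵘ.≃-sym (toℚᵘ-fromℚᵘ q)) ⟩
  toℚᵘ (fromℚᵘ p) ℚᵘ.* toℚᵘ (fromℚᵘ q) ≈⟨ ℚᵘ.≃-sym (toℚᵘ-homo-* (fromℚᵘ p) (fromℚᵘ q)) ⟩
  toℚᵘ (fromℚᵘ p * fromℚᵘ q)           ∎)
  where open ℚᵘ.≃-Reasoning

fromℚᵘ-homo-neg : ∀ p → fromℚᵘ (ℚᵘ.- p) ≡ - fromℚᵘ p
fromℚᵘ-homo-neg p = toℚᵘ-injective (begin
  toℚᵘ (fromℚᵘ (ℚᵘ.- p)) ≈⟨ toℚᵘ-fromℚᵘ (ℚᵘ.- p) ⟩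
  ℚᵘ.- p                 ≈⟨ ℚᵘ.-‿cong (ℚᵘ.≃-sym (toℚᵘ-fromℚᵘ p)) ⟩
  ℚᵘ.- toℚᵘ (fromℚᵘ p)   ≈⟨ ℚᵘ.≃-sym (toℚᵘ-homo‿- (fromℚᵘ p)) ⟩
  toℚᵘ (- fromℚᵘ p)      ∎)
  where open ℚᵘ.≃-Reasoning

ℤ→ℚ-+ : ∀ i j → ℤ→ℚ (i ℤ.+ j) ≡ ℤ→ℚ i + ℤ→ℚ j
ℤ→ℚ-+ i j = trans (fromℚᵘ-cong {mkℚᵘ (i ℤ.+ j) 0} {mkℚᵘ i 0 ℚᵘ.+ mkℚᵘ j 0} (*≡* (cross-multiplied i j)))
                  (fromℚᵘ-homo-+ (mkℚᵘ i 0) (mkℚᵘ j 0))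
  where
  cross-multiplied : ∀ i j → (i ℤ.+ j) ℤ.* ℤ.1ℤ ≡ (i ℤ.* ℤ.1ℤ ℤ.+ j ℤ.* ℤ.1ℤ) ℤ.* ℤ.1ℤ
  cross-multiplied = ℤ-Solver.solve-∀

ℤ→ℚ-* : ∀ i j → ℤ→ℚ (i ℤ.* j) ≡ ℤ→ℚ i * ℤ→ℚ j
ℤ→ℚ-* i j = fromℚᵘ-homo-* (mkℚᵘ i 0) (mkℚᵘ j 0)

ℤ→ℚ-- : ∀ i j → ℤ→ℚ (i ℤ.- j) ≡ ℤ→ℚ i - ℤ→ℚ j
ℤ→ℚ-- i j = trans (ℤ→ℚ-+ i (ℤ.- j)) (cong (_+_ (ℤ→ℚ i)) (fromℚᵘ-homo-neg (mkℚᵘ j 0)))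

ℕ→ℚ-+ : ∀ m n → ℕ→ℚ (m ℕ.+ n) ≡ ℕ→ℚ m + ℕ→ℚ n
ℕ→ℚ-+ m n = trans (cong ℤ→ℚ (ℤ.pos-+ m n)) (ℤ→ℚ-+ (+ m) (+ n))

ℕ→ℚ-* : ∀ m n → ℕ→ℚ (m ℕ.* n) ≡ ℕ→ℚ m * ℕ→ℚ n
ℕ→ℚ-* m n = trans (cong ℤ→ℚ (ℤ.pos-* m n)) (ℤ→ℚ-* (+ m) (+ n))

ℕ→ℚ-^ : ∀ m n → ℕ→ℚ (m ^ n) ≡ ℕ→ℚ m ^ℚ n
ℕ→ℚ-^ m zero    = refl
ℕ→ℚ-^ m (suc n) = trans (ℕ→ℚ-* m (m ^ n)) (cong (ℕ→ℚ m *_) (ℕ→ℚ-^ m n))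

/-as-* : ∀ i d → i / suc d ≡ ℤ→ℚ i * (+ 1 / suc d)
/-as-* i d = trans
  (fromℚᵘ-cong {mkℚᵘ i d} {mkℚᵘ i 0 ℚᵘ.* mkℚᵘ (+ 1) d}
    (*≡* (cong₂ ℤ._*_ (sym (ℤ.*-identityʳ i)) (cong (+_ ∘ suc) (ℕ.+-identityʳ d)))))
  (fromℚᵘ-homo-* (mkℚᵘ i 0) (mkℚᵘ (+ 1) d))

ℕ→ℚ-*-inverse : ∀ m → ℕ→ℚ (suc m) * (+ 1 / suc m) ≡ 1ℚ
ℕ→ℚ-*-inverse m = trans (sym (/-as-* (+ suc m) m))
  (fromℚᵘ-cong {mkℚᵘ (+ suc m) m} {mkℚᵘ (+ 1) 0}
    (*≡* (trans (ℤ.*-identityʳ (+ suc m)) (sym (ℤ.*-identityˡ (+ suc m))))))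

-- Finite sums

sumTo-cong : ∀ n {f g : ℕ → ℚ} → (∀ k → k ℕ.≤ n → f k ≡ g k) → sumTo n f ≡ sumTo n g
sumTo-cong zero    f≡g = f≡g 0 ℕ.z≤n
sumTo-cong (suc n) f≡g =
  cong₂ _+_ (sumTo-cong n (λ k k≤n → f≡g k (ℕ.m≤n⇒m≤1+n k≤n))) (f≡g (suc n) ℕ.≤-refl)

sumTo-+ : ∀ n f g → sumTo n (λ k → f k + g k) ≡ sumTo n f + sumTo n g
sumTo-+ zero    f g = refl
sumTo-+ (suc n) f g = trans (cong (_+ (f (suc n) + g (suc n))) (sumTo-+ n f g))
                            (shuffle (sumTo n f) (sumTo n g) (f (suc n)) (g (suc n)))
  where
  shuffle : ∀ a b c d → (a + b) + (c + d) ≡ (a + c) + (b + d)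
  shuffle = solve-∀ ℚ-ring

sumTo-- : ∀ n f g → sumTo n (λ k → f k - g k) ≡ sumTo n f - sumTo n g
sumTo-- zero    f g = refl
sumTo-- (suc n) f g = trans (cong (_+ (f (suc n) - g (suc n))) (sumTo-- n f g))
                            (shuffle (sumTo n f) (sumTo n g) (f (suc n)) (g (suc n)))
  where
  shuffle : ∀ a b c d → (a - b) + (c - d) ≡ (a + c) - (b + d)
  shuffle = solve-∀ ℚ-ring

sumTo-*ˡ : ∀ n c f → sumTo n (λ k → c * f k) ≡ c * sumTo n f
sumTo-*ˡ zero    c f = refl
sumTo-*ˡ (suc n) c f = trans (cong (_+ c * f (suc n)) (sumTo-*ˡ n c f)) (distrib c (sumTo n f) (f (suc n)))
  where
  distrib : ∀ a b c → a * b + a * c ≡ a * (b + c)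
  distrib = solve-∀ ℚ-ring

sumTo-suc : ∀ n f → sumTo (suc n) f ≡ f 0 + sumTo n (f ∘ suc)
sumTo-suc zero    f = refl
sumTo-suc (suc n) f = trans (cong (_+ f (suc (suc n))) (sumTo-suc n f))
                            (+-assoc (f 0) _ _)

sumTo-extend : ∀ n f → f (suc n) ≡ 0ℚ → sumTo (suc n) f ≡ sumTo n f
sumTo-extend n f f[1+n]≡0 = trans (cong (_+_ (sumTo n f)) f[1+n]≡0) (+-identityʳ (sumTo n f))

sumTo-0 : ∀ n f → (∀ k → f k ≡ 0ℚ) → sumTo n f ≡ 0ℚ
sumTo-0 zero    f f≡0 = f≡0 0
sumTo-0 (suc n) f f≡0 = trans (cong₂ _+_ (sumTo-0 n f f≡0) (f≡0 (suc n))) (+-identityʳ 0ℚ)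

-- Exponential generating functions

Seq : Set
Seq = ℕ → ℚ

infixl 6 _⊕_ _⊖_
infixr 8 _·_
infixl 7 _⋆_

_⊕_ _⊖_ : Seq → Seq → Seq
(x ⊕ y) n = x n + y n
(x ⊖ y) n = x n - y n

_·_ : ℚ → Seq → Seq
(c · x) n = c * x n

-- x ⋆ y is the coefficient sequence of the product of the exponential generating
-- functions of x and y, and ∂ is differentiation of exponential generating functions.
_⋆_ : Seq → Seq → Seq
(x ⋆ y) n = sumTo n (λ k → ℕ→ℚ (n C k) * (x k * y (n ∸ k)))

∂ : Seq → Seq
∂ x n = x (suc n)

ℕ→ℚ-pascal : ∀ n k → ℕ→ℚ (suc n C suc k) ≡ ℕ→ℚ (n C k) + ℕ→ℚ (n C suc k)
ℕ→ℚ-pascal n k = trans (cong ℕ→ℚ (sym (nCk+nC[k+1]≡[n+1]C[k+1] n k))) (ℕ→ℚ-+ (n C k) (n C suc k))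

nC[1+n]≡0 : ∀ n → n C suc n ≡ 0
nC[1+n]≡0 n = k>n⇒nCk≡0 {n} ℕ.≤-refl

⋆-leibniz : ∀ x y n → (x ⋆ y) (suc n) ≡ (∂ x ⋆ y) n + (x ⋆ ∂ y) n
⋆-leibniz x y n = begin
  (x ⋆ y) (suc n)                    ≡⟨ sumTo-suc n t ⟩
  t 0 + sumTo n (t ∘ suc)            ≡⟨ cong (_+_ (t 0)) (trans (sumTo-cong n (λ k _ → pascal-split k))
                                                             (sumTo-+ n (λ k → ℕ→ℚ (n C k) * (x (suc k) * y (n ∸ k))) r)) ⟩
  t 0 + ((∂ x ⋆ y) n + sumTo n r)    ≡⟨ swap (t 0) ((∂ x ⋆ y) n) (sumTo n r) ⟩
  (∂ x ⋆ y) n + (t 0 + sumTo n r)    ≡⟨ cong (_+_ ((∂ x ⋆ y) n)) (sym x⋆∂y) ⟩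
  (∂ x ⋆ y) n + (x ⋆ ∂ y) n          ∎
  where
  open ≡-Reasoning
  t r s : ℕ → ℚ
  t k = ℕ→ℚ (suc n C k) * (x k * y (suc n ∸ k))
  r k = ℕ→ℚ (n C suc k) * (x (suc k) * y (n ∸ k))
  s k = ℕ→ℚ (n C k) * (x k * y (suc (n ∸ k)))

  swap : ∀ a b c → a + (b + c) ≡ b + (a + c)
  swap = solve-∀ ℚ-ring

  pascal-split : ∀ k → t (suc k) ≡ ℕ→ℚ (n C k) * (x (suc k) * y (n ∸ k)) + r k
  pascal-split k = trans (cong (_* (x (suc k) * y (n ∸ k))) (ℕ→ℚ-pascal n k))
                         (distribʳ (ℕ→ℚ (n C k)) (ℕ→ℚ (n C suc k)) (x (suc k) * y (n ∸ k)))
    where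
    distribʳ : ∀ a b c → (a + b) * c ≡ a * c + b * c
    distribʳ = solve-∀ ℚ-ring

  s[1+k]≡r[k] : ∀ k → k ℕ.≤ n → s (suc k) ≡ r k
  s[1+k]≡r[k] k k≤n with ℕ.m≤n⇒m<n∨m≡n k≤n
  ... | inj₁ k<n  = cong (λ i → ℕ→ℚ (n C suc k) * (x (suc k) * y i)) (sym (ℕ.+-∸-assoc 1 k<n))
  ... | inj₂ refl = trans (vanish (y (suc (k ∸ suc k)))) (sym (vanish (y (k ∸ k))))
    where
    vanish : ∀ b → ℕ→ℚ (k C suc k) * (x (suc k) * b) ≡ 0ℚ
    vanish b = trans (cong (λ c → ℕ→ℚ c * (x (suc k) * b)) (nC[1+n]≡0 k)) (*-zeroˡ (x (suc k) * b))

  x⋆∂y : (x ⋆ ∂ y) n ≡ t 0 + sumTo n r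
  x⋆∂y = begin
    sumTo n s                 ≡⟨ sym (sumTo-extend n s (s[1+k]≡0)) ⟩
    sumTo (suc n) s           ≡⟨ sumTo-suc n s ⟩
    s 0 + sumTo n (s ∘ suc)   ≡⟨ cong (_+_ (s 0)) (sumTo-cong n s[1+k]≡r[k]) ⟩
    t 0 + sumTo n r           ∎
    where
    s[1+k]≡0 : s (suc n) ≡ 0ℚ
    s[1+k]≡0 = trans (cong (λ c → ℕ→ℚ c * (x (suc n) * y (suc (n ∸ suc n)))) (nC[1+n]≡0 n))
                     (*-zeroˡ (x (suc n) * y (suc (n ∸ suc n))))

⋆-cong : ∀ {x x′ y y′} → x ≗ x′ → y ≗ y′ → x ⋆ y ≗ x′ ⋆ y′
⋆-cong x≗x′ y≗y′ n = sumTo-cong n (λ k _ → cong₂ (λ a b → ℕ→ℚ (n C k) * (a * b)) (x≗x′ k) (y≗y′ (n ∸ k)))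

⋆-distribˡ-⊕ : ∀ x y z → x ⋆ (y ⊕ z) ≗ x ⋆ y ⊕ x ⋆ z
⋆-distribˡ-⊕ x y z n = trans (sumTo-cong n (λ k _ → distrib (ℕ→ℚ (n C k)) (x k) (y (n ∸ k)) (z (n ∸ k))))
                              (sumTo-+ n _ _)
  where
  distrib : ∀ c a b d → c * (a * (b + d)) ≡ c * (a * b) + c * (a * d)
  distrib = solve-∀ ℚ-ring

⋆-distribʳ-⊕ : ∀ x y z → (y ⊕ z) ⋆ x ≗ y ⋆ x ⊕ z ⋆ x
⋆-distribʳ-⊕ x y z n = trans (sumTo-cong n (λ k _ → distrib (ℕ→ℚ (n C k)) (y k) (z k) (x (n ∸ k))))
                              (sumTo-+ n _ _)
  where
  distrib : ∀ c a b d → c * ((a + b) * d) ≡ c * (a * d) + c * (b * d)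
  distrib = solve-∀ ℚ-ring

⋆-distribˡ-⊖ : ∀ x y z → x ⋆ (y ⊖ z) ≗ x ⋆ y ⊖ x ⋆ z
⋆-distribˡ-⊖ x y z n = trans (sumTo-cong n (λ k _ → distrib (ℕ→ℚ (n C k)) (x k) (y (n ∸ k)) (z (n ∸ k))))
                              (sumTo-- n _ _)
  where
  distrib : ∀ c a b d → c * (a * (b - d)) ≡ c * (a * b) - c * (a * d)
  distrib = solve-∀ ℚ-ring

⋆-distribʳ-⊖ : ∀ x y z → (y ⊖ z) ⋆ x ≗ y ⋆ x ⊖ z ⋆ x
⋆-distribʳ-⊖ x y z n = trans (sumTo-cong n (λ k _ → distrib (ℕ→ℚ (n C k)) (y k) (z k) (x (n ∸ k))))
                              (sumTo-- n _ _)
  where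
  distrib : ∀ c a b d → c * ((a - b) * d) ≡ c * (a * d) - c * (b * d)
  distrib = solve-∀ ℚ-ring

⋆-scaleˡ : ∀ c x y → (c · x) ⋆ y ≗ c · (x ⋆ y)
⋆-scaleˡ c x y n = trans (sumTo-cong n (λ k _ → commute (ℕ→ℚ (n C k)) c (x k) (y (n ∸ k))))
                         (sumTo-*ˡ n c _)
  where
  commute : ∀ b c a d → b * ((c * a) * d) ≡ c * (b * (a * d))
  commute = solve-∀ ℚ-ring

⋆-scaleʳ : ∀ c x y → x ⋆ (c · y) ≗ c · (x ⋆ y)
⋆-scaleʳ c x y n = trans (sumTo-cong n (λ k _ → commute (ℕ→ℚ (n C k)) c (x k) (y (n ∸ k))))
                         (sumTo-*ˡ n c _)
  where
  commute : ∀ b c a d → b * (a * (c * d)) ≡ c * (b * (a * d))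
  commute = solve-∀ ℚ-ring

⋆-comm : ∀ x y → x ⋆ y ≗ y ⋆ x
⋆-comm x y zero    = commute (x 0) (y 0)
  where
  commute : ∀ a b → 1ℚ * (a * b) ≡ 1ℚ * (b * a)
  commute = solve-∀ ℚ-ring
⋆-comm x y (suc n) = begin
  (x ⋆ y) (suc n)                  ≡⟨ ⋆-leibniz x y n ⟩
  (∂ x ⋆ y) n + (x ⋆ ∂ y) n        ≡⟨ cong₂ _+_ (⋆-comm (∂ x) y n) (⋆-comm x (∂ y) n) ⟩
  (y ⋆ ∂ x) n + (∂ y ⋆ x) n        ≡⟨ +-comm ((y ⋆ ∂ x) n) ((∂ y ⋆ x) n) ⟩
  (∂ y ⋆ x) n + (y ⋆ ∂ x) n        ≡⟨ sym (⋆-leibniz y x n) ⟩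
  (y ⋆ x) (suc n)                  ∎
  where open ≡-Reasoning

⋆-assoc : ∀ x y z → (x ⋆ y) ⋆ z ≗ x ⋆ (y ⋆ z)
⋆-assoc x y z zero    = reassoc (x 0) (y 0) (z 0)
  where
  reassoc : ∀ a b c → 1ℚ * ((1ℚ * (a * b)) * c) ≡ 1ℚ * (a * (1ℚ * (b * c)))
  reassoc = solve-∀ ℚ-ring
⋆-assoc x y z (suc n) = begin
  (x ⋆ y ⋆ z) (suc n)
    ≡⟨ ⋆-leibniz (x ⋆ y) z n ⟩
  (∂ (x ⋆ y) ⋆ z) n + (x ⋆ y ⋆ ∂ z) n
    ≡⟨ cong (_+ (x ⋆ y ⋆ ∂ z) n) (trans (⋆-cong {y = z} (⋆-leibniz x y) (λ _ → refl) n)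
                                        (⋆-distribʳ-⊕ z (∂ x ⋆ y) (x ⋆ ∂ y) n)) ⟩
  ((∂ x ⋆ y ⋆ z) n + (x ⋆ ∂ y ⋆ z) n) + (x ⋆ y ⋆ ∂ z) n
    ≡⟨ cong₂ _+_ (cong₂ _+_ (⋆-assoc (∂ x) y z n) (⋆-assoc x (∂ y) z n)) (⋆-assoc x y (∂ z) n) ⟩
  ((∂ x ⋆ (y ⋆ z)) n + (x ⋆ (∂ y ⋆ z)) n) + (x ⋆ (y ⋆ ∂ z)) n
    ≡⟨ +-assoc ((∂ x ⋆ (y ⋆ z)) n) _ _ ⟩
  (∂ x ⋆ (y ⋆ z)) n + ((x ⋆ (∂ y ⋆ z)) n + (x ⋆ (y ⋆ ∂ z)) n)
    ≡⟨ cong (_+_ ((∂ x ⋆ (y ⋆ z)) n)) (trans (sym (⋆-distribˡ-⊕ x (∂ y ⋆ z) (y ⋆ ∂ z) n))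
                                              (⋆-cong {x = x} (λ _ → refl) (sym ∘ ⋆-leibniz y z) n)) ⟩
  (∂ x ⋆ (y ⋆ z)) n + (x ⋆ ∂ (y ⋆ z)) n
    ≡⟨ sym (⋆-leibniz x (y ⋆ z) n) ⟩
  (x ⋆ (y ⋆ z)) (suc n) ∎
  where open ≡-Reasoning

^-⋆-suc : ∀ a x n → ((a ^ℚ_) ⋆ x) (suc n) ≡ a * ((a ^ℚ_) ⋆ x) n + ((a ^ℚ_) ⋆ ∂ x) n
^-⋆-suc a x n = trans (⋆-leibniz (a ^ℚ_) x n) (cong (_+ ((a ^ℚ_) ⋆ ∂ x) n) (⋆-scaleˡ a (a ^ℚ_) x n))

⋆-identityˡ : ∀ x → (0 ^ℚ_) ⋆ x ≗ x
⋆-identityˡ x zero    = unit (x 0)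
  where
  unit : ∀ a → 1ℚ * (1ℚ * a) ≡ a
  unit = solve-∀ ℚ-ring
⋆-identityˡ x (suc n) = begin
  ((0 ^ℚ_) ⋆ x) (suc n)                        ≡⟨ ^-⋆-suc 0 x n ⟩
  0 * ((0 ^ℚ_) ⋆ x) n + ((0 ^ℚ_) ⋆ ∂ x) n      ≡⟨ cong (_+_ (0 * ((0 ^ℚ_) ⋆ x) n)) (⋆-identityˡ (∂ x) n) ⟩
  0 * ((0 ^ℚ_) ⋆ x) n + x (suc n)              ≡⟨ absorb (((0 ^ℚ_) ⋆ x) n) (x (suc n)) ⟩
  x (suc n)                                    ∎
  where
  open ≡-Reasoning
  absorb : ∀ a b → 0 * a + b ≡ b
  absorb = solve-∀ ℚ-ring

^-⋆-^ : ∀ a b → (a ^ℚ_) ⋆ (b ^ℚ_) ≗ ((a + b) ^ℚ_)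
^-⋆-^ a b zero    = refl
^-⋆-^ a b (suc n) = begin
  ((a ^ℚ_) ⋆ (b ^ℚ_)) (suc n)
    ≡⟨ ^-⋆-suc a (b ^ℚ_) n ⟩
  a * ((a ^ℚ_) ⋆ (b ^ℚ_)) n + ((a ^ℚ_) ⋆ ∂ (b ^ℚ_)) n
    ≡⟨ cong (_+_ (a * ((a ^ℚ_) ⋆ (b ^ℚ_)) n)) (⋆-scaleʳ b (a ^ℚ_) (b ^ℚ_) n) ⟩
  a * ((a ^ℚ_) ⋆ (b ^ℚ_)) n + b * ((a ^ℚ_) ⋆ (b ^ℚ_)) n
    ≡⟨ cong (λ p → a * p + b * p) (^-⋆-^ a b n) ⟩
  a * (a + b) ^ℚ n + b * (a + b) ^ℚ n
    ≡⟨ distrib a b ((a + b) ^ℚ n) ⟩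
  (a + b) ^ℚ suc n
    ∎
  where
  open ≡-Reasoning
  distrib : ∀ a b c → a * c + b * c ≡ (a + b) * c
  distrib = solve-∀ ℚ-ring

1^≡1 : ∀ n → 1 ^ℚ n ≡ 1
1^≡1 zero    = refl
1^≡1 (suc n) = trans (*-identityˡ (1 ^ℚ n)) (1^≡1 n)

δ₁ : Seq
δ₁ (suc zero) = 1ℚ
δ₁ _          = 0ℚ

∂δ₁≗0^ : ∂ δ₁ ≗ (0 ^ℚ_)
∂δ₁≗0^ zero    = refl
∂δ₁≗0^ (suc n) = sym (*-zeroˡ (0 ^ℚ n))

δ₁-⋆ : ∀ x n → (δ₁ ⋆ x) (suc n) ≡ ℕ→ℚ (suc n) * x n
δ₁-⋆ x n = begin
  (δ₁ ⋆ x) (suc n)               ≡⟨ ⋆-leibniz δ₁ x n ⟩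
  (∂ δ₁ ⋆ x) n + (δ₁ ⋆ ∂ x) n    ≡⟨ cong₂ _+_ (trans (⋆-cong {y = x} ∂δ₁≗0^ (λ _ → refl) n) (⋆-identityˡ x n))
                                              (δ₁-⋆-∂ n) ⟩
  x n + ℕ→ℚ n * x n              ≡⟨ collect (x n) (ℕ→ℚ n) ⟩
  (1 + ℕ→ℚ n) * x n              ≡⟨ cong (_* x n) (sym (ℕ→ℚ-+ 1 n)) ⟩
  ℕ→ℚ (suc n) * x n              ∎
  where
  open ≡-Reasoning
  collect : ∀ a m → a + m * a ≡ (1 + m) * a
  collect = solve-∀ ℚ-ring
  δ₁-⋆-∂ : ∀ n → (δ₁ ⋆ ∂ x) n ≡ ℕ→ℚ n * x n
  δ₁-⋆-∂ zero    = vanish (x 1) (x 0)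
    where
    vanish : ∀ a b → 1 * (0 * a) ≡ 0 * b
    vanish = solve-∀ ℚ-ring
  δ₁-⋆-∂ (suc m) = δ₁-⋆ (∂ x) m

-- Bernoulli numbers

lookup-∷ʳ-last : ∀ {n} (xs : Vec ℚ n) x → lookup (xs ∷ʳ x) (fromℕ< (ℕ.n<1+n n)) ≡ x
lookup-∷ʳ-last []       x = refl
lookup-∷ʳ-last (_ ∷ xs) x = lookup-∷ʳ-last xs x

lookup-∷ʳ-init : ∀ {n} (xs : Vec ℚ n) x k (k<1+n : k ℕ.< suc n) (k<n : k ℕ.< n) →
                 lookup (xs ∷ʳ x) (fromℕ< k<1+n) ≡ lookup xs (fromℕ< k<n)
lookup-∷ʳ-init (_ ∷ xs) x zero    _           _         = refl
lookup-∷ʳ-init (_ ∷ xs) x (suc k) (s≤s k<1+n) (s≤s k<n) = lookup-∷ʳ-init xs x k k<1+n k<n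

lookup-bernoulliTable : ∀ n k (k<1+n : k ℕ.< suc n) → lookup (bernoulliTable n) (fromℕ< k<1+n) ≡ B k
lookup-bernoulliTable zero    zero    _             = refl
lookup-bernoulliTable zero    (suc k) (s≤s ())
lookup-bernoulliTable (suc n) k k<2+n with ℕ.m≤n⇒m<n∨m≡n (ℕ.s≤s⁻¹ k<2+n)
... | inj₁ k<1+n = trans (lookup-∷ʳ-init (bernoulliTable n) _ k k<2+n k<1+n) (lookup-bernoulliTable n k k<1+n)
... | inj₂ refl  = refl

sumBelow-cong : ∀ m {f g : ℕ → ℚ} → (∀ k → k ℕ.< m → f k ≡ g k) → sumBelow m f ≡ sumBelow m g
sumBelow-cong zero    f≡g = refl
sumBelow-cong (suc m) f≡g = cong₂ _+_ (sumBelow-cong m (λ k k<m → f≡g k (ℕ.m≤n⇒m≤1+n k<m))) (f≡g m ℕ.≤-refl)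

sumBelow-suc : ∀ m f → sumBelow (suc m) f ≡ sumTo m f
sumBelow-suc zero    f = +-identityˡ (f 0)
sumBelow-suc (suc m) f = cong (_+ f (suc m)) (sumBelow-suc m f)

mutual
  B-suc : ∀ n → B (suc n) ≡ - ((+ 1 / suc (suc n)) * sumTo n (λ k → ℕ→ℚ (suc (suc n) C k) * B k))
  B-suc n = trans (lookup-∷ʳ-last (bernoulliTable n) _)
    (cong (λ s → - ((+ 1 / suc (suc n)) * s))
          (trans (sumBelow-cong (suc n) (λ k k<1+n → cong (ℕ→ℚ (suc (suc n) C k) *_) (entry≡B n k k<1+n)))
                 (sumBelow-suc n _)))

  -- The left-hand side, inferred from its use above, is the lookup `entry k` local to
  -- bernoulliTable (suc n), which cannot be named outside Defs.
  entry≡B : ∀ n k → k ℕ.< suc n → _ ≡ B k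
  entry≡B n k k<1+n with k ℕ.<? suc n
  ... | yes k<1+n′ = lookup-bernoulliTable n k k<1+n′
  ... | no  k≮1+n  = ⊥-elim (k≮1+n k<1+n)

[1+n]Cn≡1+n : ∀ n → suc n C n ≡ suc n
[1+n]Cn≡1+n n = trans (nCk≡nC[n∸k] (ℕ.n≤1+n n)) (trans (cong (suc n C_) (ℕ.m+n∸n≡m 1 n)) (nC1≡n (suc n)))

bernoulli-relation : ∀ n → sumTo (suc n) (λ k → ℕ→ℚ (suc (suc n) C k) * B k) ≡ 0ℚ
bernoulli-relation n = begin
  S + ℕ→ℚ (suc (suc n) C suc n) * B (suc n)   ≡⟨ cong₂ (λ c b → S + ℕ→ℚ c * b) ([1+n]Cn≡1+n (suc n)) (B-suc n) ⟩
  S + N * (- (N⁻¹ * S))                        ≡⟨ regroup S N N⁻¹ ⟩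
  S - (N * N⁻¹) * S                            ≡⟨ cong (λ c → S - c * S) (ℕ→ℚ-*-inverse (suc n)) ⟩
  S - 1 * S                                    ≡⟨ cancel S ⟩
  0ℚ                                           ∎
  where
  open ≡-Reasoning
  S N N⁻¹ : ℚ
  S   = sumTo n (λ k → ℕ→ℚ (suc (suc n) C k) * B k)
  N   = ℕ→ℚ (suc (suc n))
  N⁻¹ = + 1 / suc (suc n)
  regroup : ∀ s n i → s + n * (- (i * s)) ≡ s - (n * i) * s
  regroup = solve-∀ ℚ-ring
  cancel : ∀ s → s - 1 * s ≡ 0ℚ
  cancel = solve-∀ ℚ-ring

B⋆1^≗B⊕δ₁ : B ⋆ (1 ^ℚ_) ≗ B ⊕ δ₁
B⋆1^≗B⊕δ₁ zero    = refl
B⋆1^≗B⊕δ₁ (suc m) = begin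
  (B ⋆ (1 ^ℚ_)) (suc m)                         ≡⟨ sumTo-cong (suc m) (λ k _ → drop-1^ (suc m ∸ k) (ℕ→ℚ (suc m C k)) (B k)) ⟩
  sumTo m t + ℕ→ℚ (suc m C suc m) * B (suc m)   ≡⟨ cong₂ (λ s c → s + ℕ→ℚ c * B (suc m)) (lower m) (nCn≡1 (suc m)) ⟩
  δ₁ (suc m) + 1 * B (suc m)                    ≡⟨ swap (δ₁ (suc m)) (B (suc m)) ⟩
  B (suc m) + δ₁ (suc m)                        ∎
  where
  open ≡-Reasoning
  t : ℕ → ℚ
  t k = ℕ→ℚ (suc m C k) * B k
  drop-1^ : ∀ j c b → c * (b * 1 ^ℚ j) ≡ c * b
  drop-1^ j c b = trans (cong (λ e → c * (b * e)) (1^≡1 j)) (cong (c *_) (*-identityʳ b))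
  swap : ∀ d b → d + 1 * b ≡ b + d
  swap = solve-∀ ℚ-ring
  lower : ∀ m → sumTo m (λ k → ℕ→ℚ (suc m C k) * B k) ≡ δ₁ (suc m)
  lower zero    = refl
  lower (suc j) = bernoulli-relation j

expm1 : Seq
expm1 = (1 ^ℚ_) ⊖ (0 ^ℚ_)

expm1⋆B≗δ₁ : expm1 ⋆ B ≗ δ₁
expm1⋆B≗δ₁ n = begin
  (expm1 ⋆ B) n                           ≡⟨ ⋆-distribʳ-⊖ B (1 ^ℚ_) (0 ^ℚ_) n ⟩
  ((1 ^ℚ_) ⋆ B) n - ((0 ^ℚ_) ⋆ B) n       ≡⟨ cong₂ _-_ (trans (⋆-comm (1 ^ℚ_) B n) (B⋆1^≗B⊕δ₁ n)) (⋆-identityˡ B n) ⟩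
  (B n + δ₁ n) - B n                      ≡⟨ cancel (B n) (δ₁ n) ⟩
  δ₁ n                                    ∎
  where
  open ≡-Reasoning
  cancel : ∀ b d → (b + d) - b ≡ d
  cancel = solve-∀ ℚ-ring

-- Lucas sequences

lucas : ℚ → ℚ → Seq
lucas p q zero          = 2
lucas p q (suc zero)    = p
lucas p q (suc (suc n)) = p * lucas p q (suc n) - q * lucas p q n

lucas-ℤ→ℚ : ∀ b c n → ℤ→ℚ (V n b c) ≡ lucas (ℤ→ℚ b) (ℤ→ℚ c) n
lucas-ℤ→ℚ b c zero          = refl
lucas-ℤ→ℚ b c (suc zero)    = refl
lucas-ℤ→ℚ b c (suc (suc n)) = begin
  ℤ→ℚ (b ℤ.* V (suc n) b c ℤ.- c ℤ.* V n b c)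
    ≡⟨ ℤ→ℚ-- (b ℤ.* V (suc n) b c) (c ℤ.* V n b c) ⟩
  ℤ→ℚ (b ℤ.* V (suc n) b c) - ℤ→ℚ (c ℤ.* V n b c)
    ≡⟨ cong₂ _-_ (ℤ→ℚ-* b (V (suc n) b c)) (ℤ→ℚ-* c (V n b c)) ⟩
  ℤ→ℚ b * ℤ→ℚ (V (suc n) b c) - ℤ→ℚ c * ℤ→ℚ (V n b c)
    ≡⟨ cong₂ (λ u v → ℤ→ℚ b * u - ℤ→ℚ c * v) (lucas-ℤ→ℚ b c (suc n)) (lucas-ℤ→ℚ b c n) ⟩
  lucas (ℤ→ℚ b) (ℤ→ℚ c) (suc (suc n))
    ∎
  where open ≡-Reasoning

LinRec₂ : ℚ → ℚ → Seq → Set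
LinRec₂ p q x = ∀ n → x (suc (suc n)) ≡ p * x (suc n) - q * x n

LinRec₂-lucas : ∀ p q → LinRec₂ p q (lucas p q)
LinRec₂-lucas p q n = refl

LinRec₂-unique : ∀ {p q x y} → LinRec₂ p q x → LinRec₂ p q y → x 0 ≡ y 0 → x 1 ≡ y 1 → x ≗ y
LinRec₂-unique {p} {q} {x} {y} rec-x rec-y x₀≡y₀ x₁≡y₁ n = proj₁ (agree n)
  where
  agree : ∀ n → x n ≡ y n × x (suc n) ≡ y (suc n)
  agree zero    = x₀≡y₀ , x₁≡y₁
  agree (suc n) with agree n
  ... | xₙ≡yₙ , xₙ₊₁≡yₙ₊₁ =
    xₙ₊₁≡yₙ₊₁ , trans (rec-x n) (trans (cong₂ (λ u v → p * u - q * v) xₙ₊₁≡yₙ₊₁ xₙ≡yₙ) (sym (rec-y n)))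

LinRec₂-scale : ∀ a {p q x} → LinRec₂ p q x → LinRec₂ (a * p) (a * a * q) (λ n → a ^ℚ n * x n)
LinRec₂-scale a {p} {q} {x} rec n =
  trans (cong (λ r → a * (a * a ^ℚ n) * r) (rec n)) (expand a p q (a ^ℚ n) (x (suc n)) (x n))
  where
  expand : ∀ a p q t u v → a * (a * t) * (p * u - q * v) ≡ a * p * (a * t * u) - a * a * q * (t * v)
  expand = solve-∀ ℚ-ring

lucas-scale : ∀ a p q → lucas (a * p) (a * a * q) ≗ (λ n → a ^ℚ n * lucas p q n)
lucas-scale a p q =
  LinRec₂-unique {a * p} {a * a * q} (LinRec₂-lucas (a * p) (a * a * q))
                 (LinRec₂-scale a {x = lucas p q} (LinRec₂-lucas p q)) refl (regroup a p)
  where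
  regroup : ∀ a p → a * p ≡ (a * 1) * p
  regroup = solve-∀ ℚ-ring

^-⋆-LinRec₂ : ∀ a {p q x} → LinRec₂ p q x → LinRec₂ (p + (a + a)) (q + a * p + a * a) ((a ^ℚ_) ⋆ x)
^-⋆-LinRec₂ a {p} {q} {x} rec n = begin
  y (suc (suc n))                      ≡⟨ ^-⋆-suc a x (suc n) ⟩
  a * y (suc n) + z (suc n)            ≡⟨ cong (_+_ (a * y (suc n))) (^-⋆-suc a (∂ x) n) ⟩
  a * y (suc n) + (a * z n + w)        ≡⟨ cong (λ r → a * y (suc n) + (a * z n + r)) w≡ ⟩
  a * y (suc n) + (a * z n + (p * z n - q * y n))
                                       ≡⟨ cong (λ r → a * r + (a * z n + (p * z n - q * y n))) (^-⋆-suc a x n) ⟩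
  a * (a * y n + z n) + (a * z n + (p * z n - q * y n))
                                       ≡⟨ regroup a p q (y n) (z n) ⟩
  (p + (a + a)) * (a * y n + z n) - (q + a * p + a * a) * y n
                                       ≡⟨ cong (λ r → (p + (a + a)) * r - (q + a * p + a * a) * y n) (sym (^-⋆-suc a x n)) ⟩
  (p + (a + a)) * y (suc n) - (q + a * p + a * a) * y n ∎
  where
  open ≡-Reasoning
  y z : Seq
  y = (a ^ℚ_) ⋆ x
  z = (a ^ℚ_) ⋆ ∂ x
  w : ℚ
  w = ((a ^ℚ_) ⋆ ∂ (∂ x)) n
  w≡ : w ≡ p * z n - q * y n
  w≡ = begin
    w                                              ≡⟨ ⋆-cong {x = a ^ℚ_} (λ _ → refl) rec n ⟩
    ((a ^ℚ_) ⋆ (p · ∂ x ⊖ q · x)) n                ≡⟨ ⋆-distribˡ-⊖ (a ^ℚ_) (p · ∂ x) (q · x) n ⟩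
    ((a ^ℚ_) ⋆ p · ∂ x) n - ((a ^ℚ_) ⋆ q · x) n    ≡⟨ cong₂ _-_ (⋆-scaleʳ p (a ^ℚ_) (∂ x) n) (⋆-scaleʳ q (a ^ℚ_) x n) ⟩
    p * z n - q * y n                              ∎
  regroup : ∀ a p q y z → a * (a * y + z) + (a * z + (p * z - q * y)) ≡ (p + (a + a)) * (a * y + z) - (q + a * p + a * a) * y
  regroup = solve-∀ ℚ-ring

-- Multiplying by e^{ax} shifts both roots of x² - p x + q by a.
^-⋆-lucas : ∀ a p q → (a ^ℚ_) ⋆ lucas p q ≗ lucas (p + (a + a)) (q + a * p + a * a)
^-⋆-lucas a p q =
  LinRec₂-unique {p + (a + a)} {q + a * p + a * a}
    (^-⋆-LinRec₂ a {p} {q} {lucas p q} (LinRec₂-lucas p q)) (LinRec₂-lucas (p + (a + a)) (q + a * p + a * a))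
                 refl (initial a p)
  where
  initial : ∀ a p → 1 * (1 * p) + 1 * ((a * 1) * 2) ≡ p + (a + a)
  initial = solve-∀ ℚ-ring

∑ : List Seq → Seq
∑ []       n = 0ℚ
∑ (x ∷ xs) n = x n + ∑ xs n

⋆-∑ : ∀ z xs → z ⋆ ∑ xs ≗ ∑ (List.map (z ⋆_) xs)
⋆-∑ z []       n = sumTo-0 n _ (λ k → vanish (ℕ→ℚ (n C k)) (z k))
  where
  vanish : ∀ c a → c * (a * 0ℚ) ≡ 0ℚ
  vanish = solve-∀ ℚ-ring
⋆-∑ z (x ∷ xs) n = trans (⋆-distribˡ-⊕ z x (∑ xs) n) (cong (_+_ ((z ⋆ x) n)) (⋆-∑ z xs n))

∑-map-cong : ∀ {A : Set} {f g : A → Seq} → (∀ a → f a ≗ g a) → ∀ as → ∑ (List.map f as) ≗ ∑ (List.map g as)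
∑-map-cong f≗g []       n = refl
∑-map-cong f≗g (a ∷ as) n = cong₂ _+_ (f≗g a n) (∑-map-cong f≗g as n)

-- (eˣ - 1) H telescopes: eˣ raises each exponent a by 1, and moves each Lucas sequence
-- one step along V(-3,9), V(-1,7), V(1,7), V(3,9).
H : Seq
H = ∑ (List.map _^ℚ_ (-3 ∷ -2 ∷ -1 ∷ 0 ∷ 1 ∷ 2 ∷ []))
  ⊖ ∑ (List.map (uncurry lucas) ((-3 , 9) ∷ (-1 , 7) ∷ (1 , 7) ∷ []))

H′ : Seq
H′ = ∑ (List.map _^ℚ_ (-2 ∷ -1 ∷ 0 ∷ 1 ∷ 2 ∷ 3 ∷ []))
   ⊖ ∑ (List.map (uncurry lucas) ((-1 , 7) ∷ (1 , 7) ∷ (3 , 9) ∷ []))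

1^⋆H : (1 ^ℚ_) ⋆ H ≗ H′
1^⋆H n = trans (⋆-distribˡ-⊖ (1 ^ℚ_) (∑ (List.map _^ℚ_ as)) (∑ (List.map (uncurry lucas) pqs)) n)
  (cong₂ _-_ (trans (⋆-∑ (1 ^ℚ_) (List.map _^ℚ_ as) n) (∑-map-cong (^-⋆-^ 1) as n))
             (trans (⋆-∑ (1 ^ℚ_) (List.map (uncurry lucas) pqs) n) (∑-map-cong (uncurry (^-⋆-lucas 1)) pqs n)))
  where
  as : List ℚ
  as = -3 ∷ -2 ∷ -1 ∷ 0 ∷ 1 ∷ 2 ∷ []
  pqs : List (ℚ × ℚ)
  pqs = (-3 , 9) ∷ (-1 , 7) ∷ (1 , 7) ∷ []

expm1⋆H : expm1 ⋆ H ≗ (3 ^ℚ_) ⊖ ((-3) ^ℚ_) ⊖ lucas 3 9 ⊕ lucas (-3) 9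
expm1⋆H n = begin
  (expm1 ⋆ H) n                        ≡⟨ ⋆-distribʳ-⊖ H (1 ^ℚ_) (0 ^ℚ_) n ⟩
  ((1 ^ℚ_) ⋆ H) n - ((0 ^ℚ_) ⋆ H) n    ≡⟨ cong₂ _-_ (1^⋆H n) (⋆-identityˡ H n) ⟩
  H′ n - H n                           ≡⟨ telescope ((-3) ^ℚ n) ((-2) ^ℚ n) ((-1) ^ℚ n) (0 ^ℚ n) (1 ^ℚ n) (2 ^ℚ n) (3 ^ℚ n)
                                                    (lucas (-3) 9 n) (lucas (-1) 7 n) (lucas 1 7 n) (lucas 3 9 n) ⟩
  ((3 ^ℚ_) ⊖ ((-3) ^ℚ_) ⊖ lucas 3 9 ⊕ lucas (-3) 9) n ∎
  where
  open ≡-Reasoning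
  telescope : ∀ e₋₃ e₋₂ e₋₁ e₀ e₁ e₂ e₃ l₀ l₁ l₂ l₃ →
    ((e₋₂ + (e₋₁ + (e₀ + (e₁ + (e₂ + (e₃ + 0ℚ)))))) - (l₁ + (l₂ + (l₃ + 0ℚ))))
      - ((e₋₃ + (e₋₂ + (e₋₁ + (e₀ + (e₁ + (e₂ + 0ℚ)))))) - (l₀ + (l₁ + (l₂ + 0ℚ))))
    ≡ e₃ - e₋₃ - l₃ + l₀
  telescope = solve-∀ ℚ-ring

lucas-1-1-+3 : ∀ n → lucas 1 1 (3 ℕ.+ n) ≡ - lucas 1 1 n
lucas-1-1-+3 n = negate (lucas 1 1 (suc n)) (lucas 1 1 n)
  where
  negate : ∀ a b → 1 * (1 * a - 1 * b) - 1 * a ≡ - b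
  negate = solve-∀ ℚ-ring

lucas-1-1-+6 : ∀ n → lucas 1 1 (6 ℕ.+ n) ≡ lucas 1 1 n
lucas-1-1-+6 n = trans (lucas-1-1-+3 (3 ℕ.+ n)) (trans (cong -_ (lucas-1-1-+3 n)) (double-negation (lucas 1 1 n)))
  where
  double-negation : ∀ a → - - a ≡ a
  double-negation = solve-∀ ℚ-ring

χ : Seq
χ k = if does (+ 6 ℤ.∣? (+ k ℤ.- + 3)) then 1 else 0

χ-+6 : ∀ k → χ (6 ℕ.+ k) ≡ χ k
χ-+6 k = cong (λ b → if b then 1 else 0) (trans (cong (does ∘ (+ 6 ℤ.∣?_)) shift)
  (does-⇔ (mk⇔ (λ 6∣i+6 → ℤ.∣m+n∣n⇒∣m 6∣i+6 ℤ.∣-refl) (λ 6∣i → ℤ.∣m∣n⇒∣m+n 6∣i ℤ.∣-refl))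
          (+ 6 ℤ.∣? ((+ k ℤ.- + 3) ℤ.+ + 6)) (+ 6 ℤ.∣? (+ k ℤ.- + 3))))
  where
  shift : + (6 ℕ.+ k) ℤ.- + 3 ≡ (+ k ℤ.- + 3) ℤ.+ + 6
  shift = trans (cong (ℤ._- + 3) (ℤ.pos-+ 6 k)) (reorder (+ k))
    where
    reorder : ∀ i → (+ 6 ℤ.+ i) ℤ.- + 3 ≡ (i ℤ.- + 3) ℤ.+ + 6
    reorder = ℤ-Solver.solve-∀

-- A filter over the sixth roots of unity: lucas 1 1 k = ζᵏ + ζ⁻ᵏ for ζ = e^{iπ/3}.
χ-roots-of-unity : ∀ k → χ k ≡ (1 - (-1) ^ℚ k) * (1 - lucas 1 1 k) * (+ 1 / 6)
χ-roots-of-unity 0 = refl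
χ-roots-of-unity 1 = refl
χ-roots-of-unity 2 = refl
χ-roots-of-unity 3 = refl
χ-roots-of-unity 4 = refl
χ-roots-of-unity 5 = refl
χ-roots-of-unity (suc (suc (suc (suc (suc (suc k)))))) =
  trans (χ-+6 k) (trans (χ-roots-of-unity k)
    (cong₂ (λ s v → (1 - s) * (1 - v) * (+ 1 / 6)) (sym (sign-+6 ((-1) ^ℚ k))) (sym (lucas-1-1-+6 k))))
  where
  sign-+6 : ∀ s → -1 * (-1 * (-1 * (-1 * (-1 * (-1 * s))))) ≡ s
  sign-+6 = solve-∀ ℚ-ring

f : Seq
f k = if does (+ 6 ℤ.∣? (+ k ℤ.- + 3)) then ℕ→ℚ (3 ^ k) else 0ℚ

f≡χ*3^ : ∀ k → f k ≡ χ k * 3 ^ℚ k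
f≡χ*3^ k with does (+ 6 ℤ.∣? (+ k ℤ.- + 3))
... | true  = trans (ℕ→ℚ-^ 3 k) (sym (*-identityˡ (3 ^ℚ k)))
... | false = sym (*-zeroˡ (3 ^ℚ k))

f≗exponentials : f ≗ (+ 1 / 6) · ((3 ^ℚ_) ⊖ ((-3) ^ℚ_) ⊖ lucas 3 9 ⊕ lucas (-3) 9)
f≗exponentials k = begin
  f k                                              ≡⟨ f≡χ*3^ k ⟩
  χ k * 3 ^ℚ k                                     ≡⟨ cong (_* 3 ^ℚ k) (χ-roots-of-unity k) ⟩
  (1 - s) * (1 - v) * (+ 1 / 6) * t                ≡⟨ expand s t v ⟩
  (+ 1 / 6) * (t - s * t - t * v + (s * t) * v)    ≡⟨ cong₂ (λ a b → (+ 1 / 6) * (t - a - b + a * v))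
                                                            (sym (^ℚ-distrib-* (-1) 3 k)) (sym (lucas-scale 3 1 1 k)) ⟩
  (+ 1 / 6) * (t - (-3) ^ℚ k - lucas 3 9 k + (-3) ^ℚ k * v)
                                                   ≡⟨ cong (λ a → (+ 1 / 6) * (t - (-3) ^ℚ k - lucas 3 9 k + a))
                                                           (sym (lucas-scale (-3) 1 1 k)) ⟩
  (+ 1 / 6) * (t - (-3) ^ℚ k - lucas 3 9 k + lucas (-3) 9 k) ∎
  where
  open ≡-Reasoning
  s t v : ℚ
  s = (-1) ^ℚ k
  t = 3 ^ℚ k
  v = lucas 1 1 k
  expand : ∀ s t v → (1 - s) * (1 - v) * (+ 1 / 6) * t ≡ (+ 1 / 6) * (t - s * t - t * v + (s * t) * v)
  expand = solve-∀ ℚ-ring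

h : Seq
h = (+ 1 / 6) · H

f≗expm1⋆h : f ≗ expm1 ⋆ h
f≗expm1⋆h k = begin
  f k                                                               ≡⟨ f≗exponentials k ⟩
  (+ 1 / 6) * ((3 ^ℚ_) ⊖ ((-3) ^ℚ_) ⊖ lucas 3 9 ⊕ lucas (-3) 9) k  ≡⟨ cong ((+ 1 / 6) *_) (sym (expm1⋆H k)) ⟩
  (+ 1 / 6) * (expm1 ⋆ H) k                                         ≡⟨ sym (⋆-scaleʳ (+ 1 / 6) expm1 H k) ⟩
  (expm1 ⋆ h) k                                                     ∎
  where open ≡-Reasoning

lhs≡f⋆B : ∀ n → lhs n ≡ (f ⋆ B) n
lhs≡f⋆B n = sumTo-cong n (λ k _ → summand k)
  where
  summand : ∀ k → (if does (+ 6 ℤ.∣? (+ k ℤ.- + 3)) then ℕ→ℚ ((n C k) ℕ.* (3 ^ k)) * B (n ∸ k) else 0ℚ)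
                ≡ ℕ→ℚ (n C k) * (f k * B (n ∸ k))
  summand k with does (+ 6 ℤ.∣? (+ k ℤ.- + 3))
  ... | true  = trans (cong (_* B (n ∸ k)) (ℕ→ℚ-* (n C k) (3 ^ k)))
                      (*-assoc (ℕ→ℚ (n C k)) (ℕ→ℚ (3 ^ k)) (B (n ∸ k)))
  ... | false = sym (vanish (ℕ→ℚ (n C k)) (B (n ∸ k)))
    where
    vanish : ∀ c b → c * (0ℚ * b) ≡ 0ℚ
    vanish = solve-∀ ℚ-ring

lhs-suc : ∀ m → lhs (suc m) ≡ ℕ→ℚ (suc m) * h m
lhs-suc m = begin
  lhs (suc m)                   ≡⟨ lhs≡f⋆B (suc m) ⟩
  (f ⋆ B) (suc m)               ≡⟨ ⋆-cong {y = B} f≗expm1⋆h (λ _ → refl) (suc m) ⟩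
  (expm1 ⋆ h ⋆ B) (suc m)       ≡⟨ ⋆-cong {y = B} (⋆-comm expm1 h) (λ _ → refl) (suc m) ⟩
  (h ⋆ expm1 ⋆ B) (suc m)       ≡⟨ ⋆-assoc h expm1 B (suc m) ⟩
  (h ⋆ (expm1 ⋆ B)) (suc m)     ≡⟨ ⋆-cong {x = h} (λ _ → refl) expm1⋆B≗δ₁ (suc m) ⟩
  (h ⋆ δ₁) (suc m)              ≡⟨ ⋆-comm h δ₁ (suc m) ⟩
  (δ₁ ⋆ h) (suc m)              ≡⟨ δ₁-⋆ h m ⟩
  ℕ→ℚ (suc m) * h m             ∎
  where open ≡-Reasoning

neg-^-even : ∀ a j → (- a) ^ℚ (j ℕ.* 2) ≡ a ^ℚ (j ℕ.* 2)
neg-^-even a zero    = refl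
neg-^-even a (suc j) = trans (cong (λ t → - a * (- a * t)) (neg-^-even a j)) (square a (a ^ℚ (j ℕ.* 2)))
  where
  square : ∀ a t → - a * (- a * t) ≡ a * (a * t)
  square = solve-∀ ℚ-ring

lucas-neg-even : ∀ p q j → lucas (-1 * p) (-1 * -1 * q) (j ℕ.* 2) ≡ lucas p q (j ℕ.* 2)
lucas-neg-even p q j = begin
  lucas (-1 * p) (-1 * -1 * q) (j ℕ.* 2)        ≡⟨ lucas-scale -1 p q (j ℕ.* 2) ⟩
  (-1) ^ℚ (j ℕ.* 2) * lucas p q (j ℕ.* 2)       ≡⟨ cong (_* lucas p q (j ℕ.* 2)) (trans (neg-^-even 1 j) (1^≡1 (j ℕ.* 2))) ⟩
  1 * lucas p q (j ℕ.* 2)                       ≡⟨ *-identityˡ (lucas p q (j ℕ.* 2)) ⟩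
  lucas p q (j ℕ.* 2)                           ∎
  where open ≡-Reasoning

H-even : ∀ i → let m = suc i ℕ.* 2 in
  H m ≡ 3 ^ℚ m + 2 * 2 ^ℚ m + 2 - 2 * lucas 1 7 m - 3 ^ℚ m * lucas 1 1 m
H-even i = begin
  H m
    ≡⟨ cong₂ _-_ (cong₂ _+_ (neg-^-even 3 (suc i)) (cong₂ _+_ (neg-^-even 2 (suc i)) (cong₂ _+_ (-1^m≡1)
                   (cong₂ _+_ (*-zeroˡ (0 ^ℚ suc (i ℕ.* 2))) (cong₂ _+_ (1^≡1 m) refl)))))
                 (cong₂ _+_ (trans (lucas-neg-even 3 9 (suc i)) (lucas-scale 3 1 1 m))
                   (cong₂ _+_ (lucas-neg-even 1 7 (suc i)) refl)) ⟩
  (3 ^ℚ m + (2 ^ℚ m + (1 + (0ℚ + (1 + (2 ^ℚ m + 0ℚ))))))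
    - (3 ^ℚ m * lucas 1 1 m + (lucas 1 7 m + (lucas 1 7 m + 0ℚ)))
    ≡⟨ collect (3 ^ℚ m) (2 ^ℚ m) (lucas 1 7 m) (lucas 1 1 m) ⟩
  3 ^ℚ m + 2 * 2 ^ℚ m + 2 - 2 * lucas 1 7 m - 3 ^ℚ m * lucas 1 1 m
    ∎
  where
  open ≡-Reasoning
  m : ℕ
  m = suc i ℕ.* 2
  -1^m≡1 : (-1) ^ℚ m ≡ 1
  -1^m≡1 = trans (neg-^-even 1 (suc i)) (1^≡1 m)
  collect : ∀ t p l u → (t + (p + (1 + (0ℚ + (1 + (p + 0ℚ)))))) - (t * u + (l + (l + 0ℚ)))
                       ≡ t + 2 * p + 2 - 2 * l - t * u
  collect = solve-∀ ℚ-ring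

lucas-1-1-even : ∀ j → (6 ∣ j ℕ.* 2 → lucas 1 1 (j ℕ.* 2) ≡ 2) × (¬ 6 ∣ j ℕ.* 2 → lucas 1 1 (j ℕ.* 2) ≡ -1)
lucas-1-1-even 0 = (λ _ → refl) , (λ 6∤0 → ⊥-elim (6∤0 (divides 0 refl)))
lucas-1-1-even 1 = (λ 6∣2 → ⊥-elim (6≰2 (∣⇒≤ 6∣2))) , (λ _ → refl)
  where
  6≰2 : ¬ 6 ℕ.≤ 2
  6≰2 (s≤s (s≤s ()))
lucas-1-1-even 2 = (λ 6∣4 → ⊥-elim (6≰4 (∣⇒≤ 6∣4))) , (λ _ → refl)
  where
  6≰4 : ¬ 6 ℕ.≤ 4
  6≰4 (s≤s (s≤s (s≤s (s≤s ()))))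
lucas-1-1-even (suc (suc (suc j))) with lucas-1-1-even j
... | 6∣⇒2 , 6∤⇒-1 =
  (λ 6∣6+x → trans (lucas-1-1-+6 x) (6∣⇒2 (∣m+n∣m⇒∣n 6∣6+x ∣-refl))) ,
  (λ 6∤6+x → trans (lucas-1-1-+6 x) (6∤⇒-1 (λ 6∣x → 6∤6+x (∣m∣n⇒∣m+n ∣-refl 6∣x))))
  where
  x : ℕ
  x = j ℕ.* 2

lhs-closed-form : ∀ i t → let m = suc i ℕ.* 2 in
  ℕ→ℚ (3 ^ m) * ((1 - lucas 1 1 m) * (+ 1 / 2)) ≡ t →
  lhs (suc m) ≡ ((+ suc m) / 3) * (((ℕ→ℚ 1 + ℕ→ℚ (2 ^ m)) + t) - (V m (+ 1) (+ 7) / 1))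
lhs-closed-form i t third-term = begin
  lhs (suc m)
    ≡⟨ lhs-suc m ⟩
  ℕ→ℚ (suc m) * ((+ 1 / 6) * H m)
    ≡⟨ cong (λ r → ℕ→ℚ (suc m) * ((+ 1 / 6) * r)) (H-even i) ⟩
  ℕ→ℚ (suc m) * ((+ 1 / 6) * (3 ^ℚ m + 2 * 2 ^ℚ m + 2 - 2 * lucas 1 7 m - 3 ^ℚ m * lucas 1 1 m))
    ≡⟨ regroup (ℕ→ℚ (suc m)) (3 ^ℚ m) (2 ^ℚ m) (lucas 1 7 m) (lucas 1 1 m) ⟩
  (ℕ→ℚ (suc m) * (+ 1 / 3)) * ((1 + 2 ^ℚ m + 3 ^ℚ m * ((1 - lucas 1 1 m) * (+ 1 / 2))) - lucas 1 7 m)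
    ≡⟨ cong₂ (λ a b → a * ((1 + b + 3 ^ℚ m * ((1 - lucas 1 1 m) * (+ 1 / 2))) - lucas 1 7 m))
             (sym (/-as-* (+ suc m) 2)) (sym (ℕ→ℚ-^ 2 m)) ⟩
  ((+ suc m) / 3) * ((1 + ℕ→ℚ (2 ^ m) + 3 ^ℚ m * ((1 - lucas 1 1 m) * (+ 1 / 2))) - lucas 1 7 m)
    ≡⟨ cong₂ (λ a b → ((+ suc m) / 3) * ((1 + ℕ→ℚ (2 ^ m) + a) - b))
             (trans (cong (_* ((1 - lucas 1 1 m) * (+ 1 / 2))) (sym (ℕ→ℚ-^ 3 m))) third-term)
             (sym (lucas-ℤ→ℚ (+ 1) (+ 7) m)) ⟩
  ((+ suc m) / 3) * (((ℕ→ℚ 1 + ℕ→ℚ (2 ^ m)) + t) - (V m (+ 1) (+ 7) / 1))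
    ∎
  where
  open ≡-Reasoning
  m : ℕ
  m = suc i ℕ.* 2
  regroup : ∀ n t p l u → n * ((+ 1 / 6) * (t + 2 * p + 2 - 2 * l - t * u))
                        ≡ (n * (+ 1 / 3)) * ((1 + p + t * ((1 - u) * (+ 1 / 2))) - l)
  regroup = solve-∀ ℚ-ring

odd≥3⇒≡1+[1+i]*2 : ∀ n → n % 2 ≡ 1 → n ≥ 3 → Σ ℕ (λ i → n ≡ suc (suc i ℕ.* 2))
odd≥3⇒≡1+[1+i]*2 n n%2≡1 n≥3 = split (n ℕ./ 2) (trans (m≡m%n+[m/n]*n n 2) (cong (ℕ._+ (n ℕ./ 2) ℕ.* 2) n%2≡1))
  where
  split : ∀ j → n ≡ suc (j ℕ.* 2) → Σ ℕ (λ i → n ≡ suc (suc i ℕ.* 2))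
  split zero    n≡1 = ⊥-elim (3≰1 (ℕ.≤-trans n≥3 (ℕ.≤-reflexive n≡1)))
    where
    3≰1 : ¬ 3 ℕ.≤ 1
    3≰1 (s≤s ())
  split (suc i) n≡1+[1+i]*2 = i , n≡1+[1+i]*2

corollary2p2 : (n : ℕ) → n % 2 ≡ 1 → n ≥ 3 →
    (6 ∣ n ∸ 1 → lhs n ≡ ((+ n) / 3) * (((ℕ→ℚ 1 + ℕ→ℚ (2 ^ (n ∸ 1))) - ((+ (3 ^ (n ∸ 1))) / 2)) - (V (n ∸ 1) (+ 1) (+ 7) / 1)))
    × (¬ (6 ∣ n ∸ 1) → lhs n ≡ ((+ n) / 3) * (((ℕ→ℚ 1 + ℕ→ℚ (2 ^ (n ∸ 1))) + ℕ→ℚ (3 ^ (n ∸ 1))) - (V (n ∸ 1) (+ 1) (+ 7) / 1)))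
corollary2p2 n n%2≡1 n≥3 with odd≥3⇒≡1+[1+i]*2 n n%2≡1 n≥3
... | i , refl =
  (λ 6∣m → lhs-closed-form i _ (trans (cong third-term (proj₁ (lucas-1-1-even (suc i)) 6∣m)) third-term-2)) ,
  (λ 6∤m → lhs-closed-form i _ (trans (cong third-term (proj₂ (lucas-1-1-even (suc i)) 6∤m)) third-term-−1))
  where
  m : ℕ
  m = suc i ℕ.* 2
  P₃ : ℚ
  P₃ = ℕ→ℚ (3 ^ m)
  third-term : ℚ → ℚ
  third-term u = P₃ * ((1 - u) * (+ 1 / 2))
  third-term-2 : third-term 2 ≡ - ((+ (3 ^ m)) / 2)
  third-term-2 = trans (negate-half P₃) (cong -_ (sym (/-as-* (+ (3 ^ m)) 1)))
    where
    negate-half : ∀ p → p * ((1 - 2) * (+ 1 / 2)) ≡ - (p * (+ 1 / 2))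
    negate-half = solve-∀ ℚ-ring
  third-term-−1 : third-term -1 ≡ P₃
  third-term-−1 = unit P₃
    where
    unit : ∀ p → p * ((1 - -1) * (+ 1 / 2)) ≡ p
    unit = solve-∀ ℚ-ring
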